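{- For any integers $n \geq 0$, $r \geq 0$, $q \geq 1$, $$B_n^{(q)}(-r) = (-1)^n \sum_{k=0}^n \frac{k!(-1)^k}{(k+1)^q} \left\{ \sum_{p=0}^n \binom{n}{p} S(p, k)\, r^{n-p} \right\} = (-1)^n \sum_{k=0}^n \frac{k!(-1)^k}{(k+1)^q} S_r(n+r, k+r).$$
   Context: For an integer $q \ge 1$, $\mathrm{Li}_q(x) = \sum_{m=1}^\infty \frac{x^m}{m^q}$ is the polylogarithm, and the poly-Bernoulli polynomials $B_n^{(q)}(x)$ are defined by the generating function $$\frac{\mathrm{Li}_q(1-e^{ -t})}{1-e^{ -t}} e^{xt} = \sum_{n=0}^{\infty} B_n^{(q)}(x) \frac{t^n}{n!}.$$ $S(p,k)$ denotes the Stirling numbers of the second kind (the number of partitions of a $p$-element set into $k$ nonempty blocks), so $S(p,k)=0$ for $k>p$ and $S(0,0)=1$. For integers $r \ge 0$, the $r$-Stirling numbers $S_r(N, m)$ are the number of ways to partition the set $\{1, 2, \dots, N\}$ into $m$ nonempty disjoint subsets such that the numbers $1, 2, \dots, r$ lie in different subsets. The convention $0^0=1$ is used. -}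

module Defs where

open import Data.Bool using (Bool; true; false; _∧_; not; if_then_else_)
open import Data.Nat as ℕ using (ℕ; zero; suc; _!; _≡ᵇ_; _<ᵇ_; _∸_)
open import Data.Nat.Properties using (m^n≢0; _!≢0)
open import Data.Nat.Combinatorics using (_C_)
open import Data.Integer as ℤ using (ℤ; +_)
open import Data.Rational as ℚ using (ℚ; 0ℚ; 1ℚ; _+_; _*_; -_; _/_)
open import Data.List using (List; []; _∷_; map; concatMap; upTo; length; filterᵇ; take)
open import Data.Bool.ListAction using (any)
open import Data.Maybe using (Maybe; just; nothing)

sumTo : ℕ → (ℕ → ℚ) → ℚ
sumTo zero    f = f 0
sumTo (suc n) f = sumTo n f + f (suc n)

ℕ→ℚ : ℕ → ℚ
ℕ→ℚ n = (+ n) / 1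

-- x ^ n in ℚ (with x ^ 0 = 1, so 0^0 = 1)
_^ℚ_ : ℚ → ℕ → ℚ
x ^ℚ zero  = 1ℚ
x ^ℚ suc n = x * (x ^ℚ n)

sgn : ℕ → ℚ
sgn n = (- 1ℚ) ^ℚ n

inv-pow : (m q : ℕ) → ℚ
inv-pow m q = (+ 1) / (suc m ℕ.^ q)
  where instance _ = m^n≢0 (suc m) q

inv-fact : ℕ → ℚ
inv-fact n = (+ 1) / (n !)
  where instance _ = n !≢0

-- Formal power series over ℚ in t, given by their ordinary coefficients:
-- f represents Σ_n f n · t^n.

PS : Set
PS = ℕ → ℚ

_⊛_ : PS → PS → PS
(f ⊛ g) n = sumTo n (λ i → f i * g (n ∸ i))

_^PS_ : PS → ℕ → PS
(f ^PS zero) zero    = 1ℚ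
(f ^PS zero) (suc n) = 0ℚ
f ^PS suc k          = f ⊛ (f ^PS k)

expS : ℚ → PS
expS x n = (x ^ℚ n) * inv-fact n

-- u(t) = 1 - e^{-t}  (constant term 0)
oneMinusExpNeg : PS
oneMinusExpNeg zero    = 0ℚ
oneMinusExpNeg (suc n) = - (sgn (suc n) * inv-fact (suc n))

-- Li_q(u)/u = Σ_{m≥1} u^{m-1} / m^q, with u = 1 - e^{-t}.
-- Since u has zero constant term, u^{j} contributes to t^n only for j ≤ n,
-- so the coefficient of t^n is the finite sum Σ_{j=0}^{n} [t^n] u^j / (j+1)^q.
LiOver : ℕ → PS
LiOver q n = sumTo n (λ j → (oneMinusExpNeg ^PS j) n * inv-pow j q)

-- Poly-Bernoulli polynomial B_n^{(q)}(x):
-- Li_q(1-e^{-t})/(1-e^{-t}) · e^{xt} = Σ_n B_n^{(q)}(x) t^n / n!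
polyBernoulli : (q n : ℕ) → ℚ → ℚ
polyBernoulli q n x = ℕ→ℚ (n !) * ((LiOver q ⊛ expS x) n)

-- A partition of {1,…,N} into m nonempty blocks is encoded canonically by
-- its block-label list (a₁,…,a_N), a_i ∈ {0,…,m-1} = label of the block
-- containing i, where blocks are labelled 0,1,2,… in order of their least
-- element (restricted growth string).  This is a bijection between set
-- partitions into m blocks and the lists accepted by `isPartition m`.

labelings : ℕ → ℕ → List (List ℕ)
labelings zero    m = [] ∷ []
labelings (suc N) m = concatMap (λ x → map (x ∷_) (labelings N m)) (upTo m)

-- scan: c = number of blocks opened so far; each new label must be an
-- already used label (< c) or the next fresh label (= c).
rgs : List ℕ → ℕ → Maybe ℕ
rgs []       c = just c
rgs (x ∷ xs) c = if x <ᵇ c then rgs xs c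
                 else if x ≡ᵇ c then rgs xs (suc c)
                 else nothing

isPartition : ℕ → List ℕ → Bool
isPartition m xs with rgs xs 0
... | just c  = c ≡ᵇ m
... | nothing = false

distinct : List ℕ → Bool
distinct []       = true
distinct (x ∷ xs) = not (any (x ≡ᵇ_) xs) ∧ distinct xs

separates : ℕ → List ℕ → Bool
separates r xs = distinct (take r xs)

rStirling : ℕ → ℕ → ℕ → ℕ
rStirling r N m =
  length (filterᵇ (λ xs → isPartition m xs ∧ separates r xs) (labelings N m))

Stirling2 : ℕ → ℕ → ℕ
Stirling2 p k = length (filterᵇ (isPartition k) (labelings p k))

-- Since 1 − e^{−t} has no constant term, B_n^{(q)}(−r) is n! times the coefficient of t^n in
-- Σ_j (1 − e^{−t})^j / (j+1)^q · e^{−rt}, and [t^i] (1 − e^{−t})^j = (−1)^{i+j} j! S(i,j) / i!;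
-- expanding the product gives the first equality. The second is the identity
-- Σ_p C(n,p) S(p,k) r^{n−p} = S_r(n+r, k+r), i.e. multiplying the exponential generating
-- function of S(·, k) by e^{rt} gives that of S_r(· + r, k + r). Both coefficient formulas follow
-- from uniqueness of power-series solutions of y′ = a y + x with prescribed constant term; the
-- differential equations come from the recurrences of S and S_r, which are read off by counting
-- restricted growth strings.
module Submission where

open import Defs

module SetPartitionCounting where

  open import Algebra.Bundles using (CommutativeMonoid)
  open import Data.Bool using (Bool; true; false; _∧_; _∨_; not; if_then_else_; T)
  open import Data.Bool.ListAction using (any; all)
  open import Data.Bool.Properties using (∧-zeroʳ; ∧-identityʳ; ∧-commutativeMonoid; ∨-∧-booleanAlgebra; T-≡; ¬-not)
  open import Data.List using (List; []; _∷_; _++_; map; concatMap; applyUpTo; length; filterᵇ; take)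
  open import Data.List.Properties using (filter-++; length-++)
  open import Data.Maybe using (Maybe; just; nothing)
  open import Data.Nat using (ℕ; zero; suc; _+_; _*_; _≤_; _<_; s≤s; z<s; _≡ᵇ_; _<ᵇ_; _≤ᵇ_)
  open import Data.Nat.Properties
  open import Data.Nat.Solver using (module +-*-Solver)
  open import Function using (_∘_)
  open import Function.Bundles using (module Equivalence)
  open import Relation.Binary.Definitions using (tri<; tri≈; tri>)
  open import Relation.Binary.PropositionalEquality
  open import Relation.Nullary using (¬_)
  open import Relation.Nullary.Decidable using (T?)
  open import Algebra.Lattice.Properties.BooleanAlgebra ∨-∧-booleanAlgebra using (deMorgan₂)
  open import Algebra.Properties.CommutativeSemigroup (CommutativeMonoid.commutativeSemigroup ∧-commutativeMonoid)
    using (xy∙z≈y∙xz) renaming (interchange to ∧-interchange)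
  open +-*-Solver
  open ≡-Reasoning

  -- Sr c n k counts the ways to label n further elements when c blocks are already open so
  -- that exactly k new blocks get opened; it equals the r-Stirling number S_c(n + c, k + c).
  Sr : ℕ → ℕ → ℕ → ℕ
  Sr c zero    zero    = 1
  Sr c zero    (suc k) = 0
  Sr c (suc n) zero    = c * Sr c n zero
  Sr c (suc n) (suc k) = c * Sr c n (suc k) + Sr (suc c) n k

  Sr-suc-index : ∀ c n k → Sr (suc c) n k ≡ suc k * Sr c n (suc k) + Sr c n k
  Sr-suc-index c zero    zero    = refl
  Sr-suc-index c zero    (suc k) = solve 1 (λ k → con 0 := (con 2 :+ k) :* con 0 :+ con 0) refl k
  Sr-suc-index c (suc n) zero = begin
    suc c * Sr (suc c) n 0                         ≡⟨ cong (suc c *_) (Sr-suc-index c n 0) ⟩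
    suc c * (1 * Sr c n 1 + Sr c n 0)              ≡⟨ solve 3 (λ c a b → (con 1 :+ c) :* (con 1 :* a :+ b)
                                                        := con 1 :* (c :* a :+ (con 1 :* a :+ b)) :+ c :* b) refl c (Sr c n 1) (Sr c n 0) ⟩
    1 * (c * Sr c n 1 + (1 * Sr c n 1 + Sr c n 0)) + c * Sr c n 0
      ≡⟨ cong (λ z → 1 * (c * Sr c n 1 + z) + c * Sr c n 0) (sym (Sr-suc-index c n 0)) ⟩
    1 * (c * Sr c n 1 + Sr (suc c) n 0) + c * Sr c n 0 ∎
  Sr-suc-index c (suc n) (suc k) = begin
    suc c * P + Sr (suc (suc c)) n k               ≡⟨ cong (suc c * P +_) (Sr-suc-index (suc c) n k) ⟩
    suc c * P + (suc k * P + Q)                    ≡⟨ cong (λ z → suc c * z + (suc k * z + Q)) (Sr-suc-index c n (suc k)) ⟩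
    suc c * (suc (suc k) * A + B) + (suc k * (suc (suc k) * A + B) + Q)
      ≡⟨ solve 5 (λ c k A B Q → (con 1 :+ c) :* ((con 2 :+ k) :* A :+ B) :+ ((con 1 :+ k) :* ((con 2 :+ k) :* A :+ B) :+ Q)
                   := (con 2 :+ k) :* (c :* A :+ ((con 2 :+ k) :* A :+ B)) :+ (c :* B :+ Q)) refl c k A B Q ⟩
    suc (suc k) * (c * A + (suc (suc k) * A + B)) + (c * B + Q)
      ≡⟨ cong (λ z → suc (suc k) * (c * A + z) + (c * B + Q)) (sym (Sr-suc-index c n (suc k))) ⟩
    suc (suc k) * (c * A + P) + (c * B + Q) ∎
    where
    P = Sr (suc c) n (suc k)
    Q = Sr (suc c) n k
    A = Sr c n (suc (suc k))
    B = Sr c n (suc k)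

  Sr-vanish : ∀ c {n k} → n < k → Sr c n k ≡ 0
  Sr-vanish c {zero}  {suc k} _         = refl
  Sr-vanish c {suc n} {suc k} (s≤s n<k) = begin
    c * Sr c n (suc k) + Sr (suc c) n k  ≡⟨ cong₂ (λ a b → c * a + b) (Sr-vanish c (m<n⇒m<1+n n<k)) (Sr-vanish (suc c) n<k) ⟩
    c * 0 + 0                            ≡⟨ cong (_+ 0) (*-zeroʳ c) ⟩
    0                                    ∎

  T⇒≡true : ∀ {b} → T b → b ≡ true
  T⇒≡true = Equivalence.to T-≡

  ¬T⇒≡false : ∀ {b} → ¬ T b → b ≡ false
  ¬T⇒≡false ¬b = ¬-not (¬b ∘ Equivalence.from T-≡)

  count : (List ℕ → Bool) → List (List ℕ) → ℕ
  count P xss = length (filterᵇ P xss)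

  count-++ : ∀ P xss yss → count P (xss ++ yss) ≡ count P xss + count P yss
  count-++ P xss yss = trans (cong length (filter-++ (T? ∘ P) xss yss)) (length-++ (filterᵇ P xss))

  count-map : ∀ P (f : List ℕ → List ℕ) xss → count P (map f xss) ≡ count (P ∘ f) xss
  count-map P f []        = refl
  count-map P f (xs ∷ xss) with P (f xs)
  ... | true  = cong suc (count-map P f xss)
  ... | false = count-map P f xss

  count-cong : ∀ {P Q} → (∀ xs → P xs ≡ Q xs) → ∀ xss → count P xss ≡ count Q xss
  count-cong P≗Q []         = refl
  count-cong {Q = Q} P≗Q (xs ∷ xss) rewrite P≗Q xs with Q xs
  ... | true  = cong suc (count-cong P≗Q xss)
  ... | false = count-cong P≗Q xss

  count-false : ∀ xss → count (λ _ → false) xss ≡ 0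
  count-false []         = refl
  count-false (_ ∷ xss) = count-false xss

  count-∧ : ∀ b P xss → count (λ xs → b ∧ P xs) xss ≡ (if b then count P xss else 0)
  count-∧ true  P xss = refl
  count-∧ false P xss = count-false xss

  sumBelow : ℕ → (ℕ → ℕ) → ℕ
  sumBelow zero    h = 0
  sumBelow (suc m) h = h 0 + sumBelow m (h ∘ suc)

  sumBelow-cong : ∀ m {g h : ℕ → ℕ} → (∀ x → g x ≡ h x) → sumBelow m g ≡ sumBelow m h
  sumBelow-cong zero    g≗h = refl
  sumBelow-cong (suc m) g≗h = cong₂ _+_ (g≗h 0) (sumBelow-cong m (g≗h ∘ suc))

  sumBelow-zero : ∀ m → sumBelow m (λ _ → 0) ≡ 0
  sumBelow-zero zero    = refl
  sumBelow-zero (suc m) = sumBelow-zero m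

  sumBelow-indicator : ∀ {c m} B → c < m → sumBelow m (λ x → if x ≡ᵇ c then B else 0) ≡ B
  sumBelow-indicator {zero}  {suc m} B _         = trans (cong (B +_) (sumBelow-zero m)) (+-identityʳ B)
  sumBelow-indicator {suc c} {suc m} B (s≤s c<m) = sumBelow-indicator B c<m

  count-concatMap : ∀ P (f : ℕ → List (List ℕ)) g m →
    count P (concatMap f (applyUpTo g m)) ≡ sumBelow m (λ x → count P (f (g x)))
  count-concatMap P f g zero    = refl
  count-concatMap P f g (suc m) =
    trans (count-++ P (f (g 0)) _) (cong (count P (f (g 0)) +_) (count-concatMap P f (g ∘ suc) m))

  count-labelings-suc : ∀ P N m →
    count P (labelings (suc N) m) ≡ sumBelow m (λ x → count (λ xs → P (x ∷ xs)) (labelings N m))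
  count-labelings-suc P N m =
    trans (count-concatMap P (λ x → map (x ∷_) (labelings N m)) (λ x → x) m)
          (sumBelow-cong m (λ x → count-map P (x ∷_) (labelings N m)))

  opened : ℕ → Maybe ℕ → Bool
  opened m (just c) = c ≡ᵇ m
  opened m nothing  = false

  isPartition-opened : ∀ m xs → isPartition m xs ≡ opened m (rgs xs 0)
  isPartition-opened m xs with rgs xs 0
  ... | just c  = refl
  ... | nothing = refl

  completions : ℕ → ℕ → ℕ → ℕ
  completions m N c = count (λ xs → opened m (rgs xs c)) (labelings N m)

  rgsBranch : ℕ → ℕ → ℕ → ℕ → ℕ
  rgsBranch c A B x = if x <ᵇ c then A else if x ≡ᵇ c then B else 0

  count-rgs-∷ : ∀ m N c x →
    count (λ xs → opened m (rgs (x ∷ xs) c)) (labelings N m)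
      ≡ rgsBranch c (completions m N c) (completions m N (suc c)) x
  count-rgs-∷ m N c x with x <ᵇ c | x ≡ᵇ c
  ... | true  | _     = refl
  ... | false | true  = refl
  ... | false | false = count-false (labelings N m)

  sumBelow-rgsBranch : ∀ c k A B →
    sumBelow (k + c) (rgsBranch c A B) ≡ c * A + (if k ≡ᵇ 0 then 0 else B)
  sumBelow-rgsBranch zero    zero    A B = refl
  sumBelow-rgsBranch zero    (suc k) A B =
    trans (cong (B +_) (trans (cong (λ z → sumBelow z (λ _ → 0)) (+-identityʳ k)) (sumBelow-zero k))) (+-identityʳ B)
  sumBelow-rgsBranch (suc c) k       A B = begin
    sumBelow (k + suc c) (rgsBranch (suc c) A B)      ≡⟨ cong (λ z → sumBelow z (rgsBranch (suc c) A B)) (+-suc k c) ⟩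
    A + sumBelow (k + c) (rgsBranch c A B)            ≡⟨ cong (A +_) (sumBelow-rgsBranch c k A B) ⟩
    A + (c * A + (if k ≡ᵇ 0 then 0 else B))            ≡⟨ sym (+-assoc A (c * A) _) ⟩
    suc c * A + (if k ≡ᵇ 0 then 0 else B)              ∎

  completions-suc : ∀ N c k →
    completions (k + c) (suc N) c ≡ c * completions (k + c) N c + (if k ≡ᵇ 0 then 0 else completions (k + c) N (suc c))
  completions-suc N c k = begin
    completions m (suc N) c
      ≡⟨ count-labelings-suc (λ xs → opened m (rgs xs c)) N m ⟩
    sumBelow m (λ x → count (λ xs → opened m (rgs (x ∷ xs) c)) (labelings N m))
      ≡⟨ sumBelow-cong m (count-rgs-∷ m N c) ⟩
    sumBelow m (rgsBranch c (completions m N c) (completions m N (suc c)))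
      ≡⟨ sumBelow-rgsBranch c k _ _ ⟩
    c * completions m N c + (if k ≡ᵇ 0 then 0 else completions m N (suc c)) ∎
    where m = k + c

  completions≡Sr : ∀ N c k → completions (k + c) N c ≡ Sr c N k
  completions≡Sr zero    c zero    rewrite T⇒≡true (≡⇒≡ᵇ c c refl) = refl
  completions≡Sr zero    c (suc k) rewrite ¬T⇒≡false (m≢1+n+m c {k} ∘ ≡ᵇ⇒≡ c (suc k + c)) = refl
  completions≡Sr (suc N) c zero    = begin
    completions c (suc N) c         ≡⟨ completions-suc N c 0 ⟩
    c * completions c N c + 0       ≡⟨ +-identityʳ _ ⟩
    c * completions c N c           ≡⟨ cong (c *_) (completions≡Sr N c zero) ⟩
    c * Sr c N zero                 ∎
  completions≡Sr (suc N) c (suc k) = begin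
    completions m (suc N) c                              ≡⟨ completions-suc N c (suc k) ⟩
    c * completions m N c + completions m N (suc c)
      ≡⟨ cong₂ (λ a b → c * a + b) (completions≡Sr N c (suc k))
               (trans (cong (λ z → completions z N (suc c)) (sym (+-suc k c))) (completions≡Sr N (suc c) k)) ⟩
    c * Sr c N (suc k) + Sr (suc c) N k                  ∎
    where m = suc k + c

  Stirling2≡Sr : ∀ p k → Stirling2 p k ≡ Sr 0 p k
  Stirling2≡Sr p k = begin
    Stirling2 p k                 ≡⟨ count-cong (isPartition-opened k) (labelings p k) ⟩
    completions k p 0             ≡⟨ cong (λ m → completions m p 0) (sym (+-identityʳ k)) ⟩
    completions (k + 0) p 0       ≡⟨ completions≡Sr p 0 k ⟩
    Sr 0 p k                      ∎

  -- In a valid scan, R distinct labels ≥ c at the front are forced to be c, c + 1, …, c + R − 1.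
  freshPrefix : ℕ → ℕ → ℕ → List ℕ → Bool
  freshPrefix m R c xs = opened m (rgs xs c) ∧ (distinct (take R xs) ∧ all (c ≤ᵇ_) (take R xs))

  not≡ᵇ∧≤ᵇ : ∀ c y → (not (c ≡ᵇ y) ∧ (c ≤ᵇ y)) ≡ (suc c ≤ᵇ y)
  not≡ᵇ∧≤ᵇ zero    zero    = refl
  not≡ᵇ∧≤ᵇ zero    (suc y) = refl
  not≡ᵇ∧≤ᵇ (suc c) zero    = refl
  not≡ᵇ∧≤ᵇ (suc c) (suc y) = trans (cong (not (c ≡ᵇ y) ∧_) (<ᵇ-suc c y)) (not≡ᵇ∧≤ᵇ c y)
    where
    <ᵇ-suc : ∀ c y → (c <ᵇ suc y) ≡ (c ≤ᵇ y)
    <ᵇ-suc zero    y = refl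
    <ᵇ-suc (suc c) y = refl

  all-≤ᵇ-suc : ∀ c ys → (not (any (c ≡ᵇ_) ys) ∧ all (c ≤ᵇ_) ys) ≡ all (suc c ≤ᵇ_) ys
  all-≤ᵇ-suc c []       = refl
  all-≤ᵇ-suc c (y ∷ ys) = begin
    not ((c ≡ᵇ y) ∨ any (c ≡ᵇ_) ys) ∧ ((c ≤ᵇ y) ∧ all (c ≤ᵇ_) ys)
      ≡⟨ cong (_∧ ((c ≤ᵇ y) ∧ all (c ≤ᵇ_) ys)) (deMorgan₂ (c ≡ᵇ y) (any (c ≡ᵇ_) ys)) ⟩
    (not (c ≡ᵇ y) ∧ not (any (c ≡ᵇ_) ys)) ∧ ((c ≤ᵇ y) ∧ all (c ≤ᵇ_) ys)
      ≡⟨ ∧-interchange (not (c ≡ᵇ y)) (not (any (c ≡ᵇ_) ys)) (c ≤ᵇ y) (all (c ≤ᵇ_) ys) ⟩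
    (not (c ≡ᵇ y) ∧ (c ≤ᵇ y)) ∧ (not (any (c ≡ᵇ_) ys) ∧ all (c ≤ᵇ_) ys)
      ≡⟨ cong₂ _∧_ (not≡ᵇ∧≤ᵇ c y) (all-≤ᵇ-suc c ys) ⟩
    (suc c ≤ᵇ y) ∧ all (suc c ≤ᵇ_) ys ∎

  all-0≤ᵇ : ∀ ys → all (0 ≤ᵇ_) ys ≡ true
  all-0≤ᵇ []       = refl
  all-0≤ᵇ (_ ∷ ys) = all-0≤ᵇ ys

  freshPrefix-∷ : ∀ m R c x xs → freshPrefix m (suc R) c (x ∷ xs) ≡ (x ≡ᵇ c) ∧ freshPrefix m R (suc c) xs
  freshPrefix-∷ m R c x xs with <-cmp x c
  ... | tri< x<c x≢c _
    rewrite T⇒≡true (<⇒<ᵇ x<c) | ¬T⇒≡false (x≢c ∘ ≡ᵇ⇒≡ x c) | ¬T⇒≡false (<⇒≱ x<c ∘ ≤ᵇ⇒≤ c x)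
    = trans (cong (opened m (rgs xs c) ∧_) (∧-zeroʳ _)) (∧-zeroʳ _)
  ... | tri> _ x≢c c<x
    rewrite ¬T⇒≡false (<⇒≱ c<x ∘ <⇒≤ ∘ <ᵇ⇒< x c) | ¬T⇒≡false (x≢c ∘ ≡ᵇ⇒≡ x c)
    = refl
  ... | tri≈ _ refl _
    rewrite ¬T⇒≡false (<-irrefl refl ∘ <ᵇ⇒< x x) | T⇒≡true (≡⇒≡ᵇ x x refl) | T⇒≡true (≤⇒≤ᵇ (≤-refl {x}))
          | sym (all-≤ᵇ-suc x (take R xs))
    = cong (opened m (rgs xs (suc x)) ∧_) (xy∙z≈y∙xz (not (any (x ≡ᵇ_) (take R xs))) _ _)

  count-freshPrefix-suc : ∀ {m c} R N → c < m →
    count (freshPrefix m (suc R) c) (labelings (suc N) m) ≡ count (freshPrefix m R (suc c)) (labelings N m)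
  count-freshPrefix-suc {m} {c} R N c<m = begin
    count (freshPrefix m (suc R) c) (labelings (suc N) m)
      ≡⟨ count-labelings-suc (freshPrefix m (suc R) c) N m ⟩
    sumBelow m (λ x → count (λ xs → freshPrefix m (suc R) c (x ∷ xs)) (labelings N m))
      ≡⟨ sumBelow-cong m (λ x → trans (count-cong (freshPrefix-∷ m R c x) (labelings N m))
                                      (count-∧ (x ≡ᵇ c) (freshPrefix m R (suc c)) (labelings N m))) ⟩
    sumBelow m (λ x → if x ≡ᵇ c then count (freshPrefix m R (suc c)) (labelings N m) else 0)
      ≡⟨ sumBelow-indicator _ c<m ⟩
    count (freshPrefix m R (suc c)) (labelings N m) ∎

  count-freshPrefix : ∀ {m} R c N → c + R ≤ m →
    count (freshPrefix m R c) (labelings (R + N) m) ≡ completions m N (c + R)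
  count-freshPrefix {m} zero    c N _ = begin
    count (freshPrefix m 0 c) (labelings N m)  ≡⟨ count-cong (λ xs → ∧-identityʳ (opened m (rgs xs c))) (labelings N m) ⟩
    completions m N c                          ≡⟨ cong (completions m N) (sym (+-identityʳ c)) ⟩
    completions m N (c + 0)                    ∎
  count-freshPrefix {m} (suc R) c N c+R≤m = begin
    count (freshPrefix m (suc R) c) (labelings (suc (R + N)) m)
      ≡⟨ count-freshPrefix-suc R (R + N) (<-≤-trans (m<m+n c z<s) c+R≤m) ⟩
    count (freshPrefix m R (suc c)) (labelings (R + N) m)
      ≡⟨ count-freshPrefix R (suc c) N (subst (_≤ m) (+-suc c R) c+R≤m) ⟩
    completions m N (suc c + R)
      ≡⟨ cong (completions m N) (sym (+-suc c R)) ⟩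
    completions m N (c + suc R) ∎

  rStirling≡Sr : ∀ r n k → rStirling r (n + r) (k + r) ≡ Sr r n k
  rStirling≡Sr r n k = begin
    rStirling r (n + r) (k + r)                         ≡⟨ count-cong separated-fresh (labelings (n + r) m) ⟩
    count (freshPrefix m r 0) (labelings (n + r) m)     ≡⟨ cong (λ N → count (freshPrefix m r 0) (labelings N m)) (+-comm n r) ⟩
    count (freshPrefix m r 0) (labelings (r + n) m)     ≡⟨ count-freshPrefix r 0 n (m≤n+m r k) ⟩
    completions m n r                                   ≡⟨ completions≡Sr n r k ⟩
    Sr r n k                                            ∎
    where
    m = k + r
    separated-fresh : ∀ xs → (isPartition m xs ∧ separates r xs) ≡ freshPrefix m r 0 xs
    separated-fresh xs = cong₂ _∧_ (isPartition-opened m xs)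
      (sym (trans (cong (distinct (take r xs) ∧_) (all-0≤ᵇ (take r xs))) (∧-identityʳ _)))

  Stirling2-suc : ∀ n k → Stirling2 (suc n) (suc k) ≡ suc k * Stirling2 n (suc k) + Stirling2 n k
  Stirling2-suc n k = begin
    Stirling2 (suc n) (suc k)              ≡⟨ Stirling2≡Sr (suc n) (suc k) ⟩
    Sr 1 n k                               ≡⟨ Sr-suc-index 0 n k ⟩
    suc k * Sr 0 n (suc k) + Sr 0 n k      ≡⟨ sym (cong₂ (λ a b → suc k * a + b) (Stirling2≡Sr n (suc k)) (Stirling2≡Sr n k)) ⟩
    suc k * Stirling2 n (suc k) + Stirling2 n k ∎

  Stirling2-vanish : ∀ {p k} → p < k → Stirling2 p k ≡ 0
  Stirling2-vanish {p} {k} p<k = trans (Stirling2≡Sr p k) (Sr-vanish 0 p<k)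

open import Data.Integer as ℤ using ()
import Data.Integer.Properties as ℤ
open import Data.Nat as ℕ using (ℕ; zero; suc; _≤_; _<_; _!; _∸_; _^_; z≤n; s≤s)
import Data.Nat.Properties as ℕ
open import Data.Nat.Combinatorics using (_C_; nCk≡n!/k![n-k]!; k![n∸k]!∣n!)
open import Data.Nat.Coprimality using (1-coprimeTo) renaming (sym to coprime-sym)
open import Data.Nat.DivMod using (m/n*n≡m)
open import Data.Product using (_×_; _,_)
open import Data.Rational using (ℚ; mkℚ; _*_; _+_; -_; _-_; 0ℚ; 1ℚ; _/_)
open import Data.Rational.Properties
open import Data.Rational.Solver using (module +-*-Solver)
open import Relation.Binary.PropositionalEquality using (_≡_; refl; sym; trans; cong; cong₂; module ≡-Reasoning)
open SetPartitionCounting using (Sr; Stirling2-suc; Stirling2-vanish; Stirling2≡Sr; rStirling≡Sr)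
open +-*-Solver
open ≡-Reasoning

ℕ→ℚ-mkℚ : ∀ n → ℕ→ℚ n ≡ mkℚ (ℤ.+ n) 0 (coprime-sym (1-coprimeTo n))
ℕ→ℚ-mkℚ n = ↥p/↧p≡p (mkℚ (ℤ.+ n) 0 (coprime-sym (1-coprimeTo n)))

ℕ→ℚ-suc : ∀ n → ℕ→ℚ (suc n) ≡ 1ℚ + ℕ→ℚ n
-- The middle fraction is what 1ℚ + mkℚ (+ n) 0 _ unfolds to by the definition of _+_.
ℕ→ℚ-suc n = begin
  ℕ→ℚ (suc n)                                          ≡⟨ /-cong numerator refl ⟩
  ((ℤ.+ 1) ℤ.* (ℤ.+ 1) ℤ.+ (ℤ.+ n) ℤ.* (ℤ.+ 1)) / 1    ≡⟨ cong (1ℚ +_) (sym (ℕ→ℚ-mkℚ n)) ⟩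
  1ℚ + ℕ→ℚ n                                           ∎
  where
  numerator : ℤ.+ suc n ≡ (ℤ.+ 1) ℤ.* (ℤ.+ 1) ℤ.+ (ℤ.+ n) ℤ.* (ℤ.+ 1)
  numerator = cong (λ z → ℤ.+ 1 ℤ.+ z) (sym (ℤ.*-identityʳ (ℤ.+ n)))

ℕ→ℚ-homo-+ : ∀ m n → ℕ→ℚ (m ℕ.+ n) ≡ ℕ→ℚ m + ℕ→ℚ n
ℕ→ℚ-homo-+ zero    n = sym (+-identityˡ (ℕ→ℚ n))
ℕ→ℚ-homo-+ (suc m) n = begin
  ℕ→ℚ (suc (m ℕ.+ n))       ≡⟨ ℕ→ℚ-suc (m ℕ.+ n) ⟩
  1ℚ + ℕ→ℚ (m ℕ.+ n)        ≡⟨ cong (1ℚ +_) (ℕ→ℚ-homo-+ m n) ⟩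
  1ℚ + (ℕ→ℚ m + ℕ→ℚ n)      ≡⟨ sym (+-assoc 1ℚ (ℕ→ℚ m) (ℕ→ℚ n)) ⟩
  (1ℚ + ℕ→ℚ m) + ℕ→ℚ n      ≡⟨ cong (_+ ℕ→ℚ n) (sym (ℕ→ℚ-suc m)) ⟩
  ℕ→ℚ (suc m) + ℕ→ℚ n       ∎

ℕ→ℚ-homo-* : ∀ m n → ℕ→ℚ (m ℕ.* n) ≡ ℕ→ℚ m * ℕ→ℚ n
ℕ→ℚ-homo-* zero    n = sym (*-zeroˡ (ℕ→ℚ n))
ℕ→ℚ-homo-* (suc m) n = begin
  ℕ→ℚ (n ℕ.+ m ℕ.* n)       ≡⟨ ℕ→ℚ-homo-+ n (m ℕ.* n) ⟩
  ℕ→ℚ n + ℕ→ℚ (m ℕ.* n)     ≡⟨ cong (ℕ→ℚ n +_) (ℕ→ℚ-homo-* m n) ⟩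
  ℕ→ℚ n + ℕ→ℚ m * ℕ→ℚ n     ≡⟨ solve 2 (λ a b → b :+ a :* b := (con 1ℚ :+ a) :* b) refl (ℕ→ℚ m) (ℕ→ℚ n) ⟩
  (1ℚ + ℕ→ℚ m) * ℕ→ℚ n      ≡⟨ cong (_* ℕ→ℚ n) (sym (ℕ→ℚ-suc m)) ⟩
  ℕ→ℚ (suc m) * ℕ→ℚ n       ∎

ℕ→ℚ-homo-^ : ∀ m e → ℕ→ℚ (m ^ e) ≡ ℕ→ℚ m ^ℚ e
ℕ→ℚ-homo-^ m zero    = refl
ℕ→ℚ-homo-^ m (suc e) = trans (ℕ→ℚ-homo-* m (m ^ e)) (cong (ℕ→ℚ m *_) (ℕ→ℚ-homo-^ m e))

1/d*d≡1 : ∀ d .{{_ : ℕ.NonZero d}} → ((ℤ.+ 1) / d) * ℕ→ℚ d ≡ 1ℚ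
1/d*d≡1 (suc d) = begin
  ((ℤ.+ 1) / suc d) * ℕ→ℚ (suc d)    ≡⟨ cong₂ _*_ (↥p/↧p≡p 1/d) (ℕ→ℚ-mkℚ (suc d)) ⟩
  1/d * d/1                          ≡⟨ *-inverseˡ d/1 ⟩
  1ℚ                                 ∎
  where
  1/d = mkℚ (ℤ.+ 1) d (1-coprimeTo (suc d))
  d/1 = mkℚ (ℤ.+ suc d) 0 (coprime-sym (1-coprimeTo (suc d)))

!*inv-fact≡1 : ∀ n → ℕ→ℚ (n !) * inv-fact n ≡ 1ℚ
!*inv-fact≡1 n = trans (*-comm (ℕ→ℚ (n !)) (inv-fact n)) (1/d*d≡1 (n !) {{n ℕ.!≢0}})

inv-fact-suc : ∀ n → ℕ→ℚ (suc n) * inv-fact (suc n) ≡ inv-fact n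
inv-fact-suc n = begin
  N * I′                      ≡⟨ solve 2 (λ N I′ → N :* I′ := N :* I′ :* con 1ℚ) refl N I′ ⟩
  N * I′ * 1ℚ                 ≡⟨ cong (N * I′ *_) (sym (!*inv-fact≡1 n)) ⟩
  N * I′ * (F * I)            ≡⟨ solve 4 (λ N I′ F I → N :* I′ :* (F :* I) := I :* ((N :* F) :* I′)) refl N I′ F I ⟩
  I * ((N * F) * I′)          ≡⟨ cong (λ z → I * (z * I′)) (sym (ℕ→ℚ-homo-* (suc n) (n !))) ⟩
  I * (ℕ→ℚ (suc n !) * I′)    ≡⟨ cong (I *_) (!*inv-fact≡1 (suc n)) ⟩
  I * 1ℚ                      ≡⟨ *-identityʳ I ⟩
  I                           ∎
  where N = ℕ→ℚ (suc n); I′ = inv-fact (suc n); I = inv-fact n; F = ℕ→ℚ (n !)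

ℕ→ℚ-suc-*-cancelˡ : ∀ n {x y} → ℕ→ℚ (suc n) * x ≡ ℕ→ℚ (suc n) * y → x ≡ y
ℕ→ℚ-suc-*-cancelˡ n {x} {y} eq = begin
  x                  ≡⟨ sym (*-identityˡ x) ⟩
  1ℚ * x             ≡⟨ cong (_* x) (sym (1/d*d≡1 (suc n))) ⟩
  (w * N) * x        ≡⟨ *-assoc w N x ⟩
  w * (N * x)        ≡⟨ cong (w *_) eq ⟩
  w * (N * y)        ≡⟨ sym (*-assoc w N y) ⟩
  (w * N) * y        ≡⟨ cong (_* y) (1/d*d≡1 (suc n)) ⟩
  1ℚ * y             ≡⟨ *-identityˡ y ⟩
  y                  ∎
  where w = (ℤ.+ 1) / suc n; N = ℕ→ℚ (suc n)

binomial-ℚ : ∀ {n p} → p ≤ n → ℕ→ℚ (n C p) ≡ ℕ→ℚ (n !) * inv-fact p * inv-fact (n ∸ p)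
binomial-ℚ {n} {p} p≤n = begin
  Cₙₚ                                              ≡⟨ solve 1 (λ x → x := x :* con 1ℚ :* con 1ℚ) refl Cₙₚ ⟩
  Cₙₚ * 1ℚ * 1ℚ                                    ≡⟨ cong₂ (λ x y → Cₙₚ * x * y) (sym (!*inv-fact≡1 p)) (sym (!*inv-fact≡1 (n ∸ p))) ⟩
  Cₙₚ * (P * inv-fact p) * (Q * inv-fact (n ∸ p))  ≡⟨ solve 5 (λ c a i b j → c :* (a :* i) :* (b :* j) := c :* (a :* b) :* i :* j)
                                                      refl Cₙₚ P (inv-fact p) Q (inv-fact (n ∸ p)) ⟩
  Cₙₚ * (P * Q) * inv-fact p * inv-fact (n ∸ p)    ≡⟨ cong (λ z → z * inv-fact p * inv-fact (n ∸ p)) (sym n!≡C*P*Q) ⟩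
  ℕ→ℚ (n !) * inv-fact p * inv-fact (n ∸ p)        ∎
  where
  Cₙₚ = ℕ→ℚ (n C p); P = ℕ→ℚ (p !); Q = ℕ→ℚ ((n ∸ p) !)
  n!≡C*P*Q : ℕ→ℚ (n !) ≡ Cₙₚ * (P * Q)
  n!≡C*P*Q = begin
    ℕ→ℚ (n !)                             ≡⟨ cong ℕ→ℚ (sym C*[p!*[n∸p]!]≡n!) ⟩
    ℕ→ℚ ((n C p) ℕ.* (p ! ℕ.* (n ∸ p) !))  ≡⟨ ℕ→ℚ-homo-* (n C p) _ ⟩
    Cₙₚ * ℕ→ℚ (p ! ℕ.* (n ∸ p) !)          ≡⟨ cong (Cₙₚ *_) (ℕ→ℚ-homo-* (p !) ((n ∸ p) !)) ⟩
    Cₙₚ * (P * Q)                         ∎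
    where
    C*[p!*[n∸p]!]≡n! : (n C p) ℕ.* (p ! ℕ.* (n ∸ p) !) ≡ n !
    C*[p!*[n∸p]!]≡n! = trans (cong (ℕ._* (p ! ℕ.* (n ∸ p) !)) (nCk≡n!/k![n-k]! p≤n))
                             (m/n*n≡m {{p ℕ.!* (n ∸ p) !≢0}} (k![n∸k]!∣n! p≤n))

sgn-+ : ∀ a b → sgn (a ℕ.+ b) ≡ sgn a * sgn b
sgn-+ zero    b = sym (*-identityˡ (sgn b))
sgn-+ (suc a) b = trans (cong ((- 1ℚ) *_) (sgn-+ a b)) (sym (*-assoc (- 1ℚ) (sgn a) (sgn b)))

neg-^ℚ : ∀ x e → (- x) ^ℚ e ≡ sgn e * (x ^ℚ e)
neg-^ℚ x zero    = refl
neg-^ℚ x (suc e) = trans (cong ((- x) *_) (neg-^ℚ x e))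
  (solve 3 (λ x s y → (:- x) :* (s :* y) := (con (- 1ℚ) :* s) :* (x :* y)) refl x (sgn e) (x ^ℚ e))

sumTo-cong : ∀ n {f g : ℕ → ℚ} → (∀ i → i ≤ n → f i ≡ g i) → sumTo n f ≡ sumTo n g
sumTo-cong zero    f≗g = f≗g 0 z≤n
sumTo-cong (suc n) f≗g = cong₂ _+_ (sumTo-cong n (λ i i≤n → f≗g i (ℕ.m≤n⇒m≤1+n i≤n))) (f≗g (suc n) ℕ.≤-refl)

sumTo-+ : ∀ n (f g : ℕ → ℚ) → sumTo n (λ i → f i + g i) ≡ sumTo n f + sumTo n g
sumTo-+ zero    f g = refl
sumTo-+ (suc n) f g = begin
  sumTo n (λ i → f i + g i) + (f (suc n) + g (suc n))   ≡⟨ cong (_+ (f (suc n) + g (suc n))) (sumTo-+ n f g) ⟩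
  (sumTo n f + sumTo n g) + (f (suc n) + g (suc n))     ≡⟨ solve 4 (λ a b c d → (a :+ b) :+ (c :+ d) := (a :+ c) :+ (b :+ d)) refl
                                                               (sumTo n f) (sumTo n g) (f (suc n)) (g (suc n)) ⟩
  (sumTo n f + f (suc n)) + (sumTo n g + g (suc n))     ∎

sumTo-*ˡ : ∀ n c (f : ℕ → ℚ) → sumTo n (λ i → c * f i) ≡ c * sumTo n f
sumTo-*ˡ zero    c f = refl
sumTo-*ˡ (suc n) c f = trans (cong (_+ (c * f (suc n))) (sumTo-*ˡ n c f)) (sym (*-distribˡ-+ c (sumTo n f) (f (suc n))))

sumTo-*ʳ : ∀ n c (f : ℕ → ℚ) → sumTo n (λ i → f i * c) ≡ sumTo n f * c
sumTo-*ʳ n c f = begin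
  sumTo n (λ i → f i * c)   ≡⟨ sumTo-cong n (λ i _ → *-comm (f i) c) ⟩
  sumTo n (λ i → c * f i)   ≡⟨ sumTo-*ˡ n c f ⟩
  c * sumTo n f             ≡⟨ *-comm c (sumTo n f) ⟩
  sumTo n f * c             ∎

sumTo-neg : ∀ n (f : ℕ → ℚ) → sumTo n (λ i → - f i) ≡ - sumTo n f
sumTo-neg zero    f = refl
sumTo-neg (suc n) f = trans (cong (_+ (- f (suc n))) (sumTo-neg n f)) (sym (neg-distrib-+ (sumTo n f) (f (suc n))))

sumTo-zero : ∀ n {f : ℕ → ℚ} → (∀ i → f i ≡ 0ℚ) → sumTo n f ≡ 0ℚ
sumTo-zero zero    f≗0 = f≗0 0
sumTo-zero (suc n) f≗0 = cong₂ _+_ (sumTo-zero n f≗0) (f≗0 (suc n))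

sumTo-suc-head : ∀ n (f : ℕ → ℚ) → sumTo (suc n) f ≡ f 0 + sumTo n (λ i → f (suc i))
sumTo-suc-head zero    f = refl
sumTo-suc-head (suc n) f = begin
  sumTo (suc n) f + f (suc (suc n))                         ≡⟨ cong (_+ f (suc (suc n))) (sumTo-suc-head n f) ⟩
  (f 0 + sumTo n (λ i → f (suc i))) + f (suc (suc n))       ≡⟨ +-assoc (f 0) (sumTo n (λ i → f (suc i))) (f (suc (suc n))) ⟩
  f 0 + sumTo (suc n) (λ i → f (suc i))                     ∎

sumTo-swap : ∀ n m (f : ℕ → ℕ → ℚ) → sumTo n (λ i → sumTo m (f i)) ≡ sumTo m (λ j → sumTo n (λ i → f i j))
sumTo-swap zero    m f = refl
sumTo-swap (suc n) m f = begin
  sumTo n (λ i → sumTo m (f i)) + sumTo m (f (suc n))              ≡⟨ cong (_+ sumTo m (f (suc n))) (sumTo-swap n m f) ⟩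
  sumTo m (λ j → sumTo n (λ i → f i j)) + sumTo m (f (suc n))      ≡⟨ sym (sumTo-+ m (λ j → sumTo n (λ i → f i j)) (f (suc n))) ⟩
  sumTo m (λ j → sumTo n (λ i → f i j) + f (suc n) j)              ∎

sumTo-extend : ∀ {m n} (f : ℕ → ℚ) → m ≤ n → (∀ j → m < j → f j ≡ 0ℚ) → sumTo m f ≡ sumTo n f
sumTo-extend {m} {n} f m≤n f>m≡0 = trans (pad (n ∸ m)) (cong (λ z → sumTo z f) (ℕ.m∸n+n≡m m≤n))
  where
  pad : ∀ k → sumTo m f ≡ sumTo (k ℕ.+ m) f
  pad zero    = refl
  pad (suc k) = begin
    sumTo m f                                   ≡⟨ pad k ⟩
    sumTo (k ℕ.+ m) f                           ≡⟨ sym (+-identityʳ _) ⟩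
    sumTo (k ℕ.+ m) f + 0ℚ                      ≡⟨ cong (sumTo (k ℕ.+ m) f +_) (sym (f>m≡0 _ (s≤s (ℕ.m≤n+m m k)))) ⟩
    sumTo (k ℕ.+ m) f + f (suc (k ℕ.+ m))       ∎

∂ : PS → PS
∂ f n = ℕ→ℚ (suc n) * f (suc n)

∂-unique : ∀ {g h X : PS} a → g 0 ≡ h 0 →
  (∀ n → ∂ g n ≡ a * g n + X n) → (∀ n → ∂ h n ≡ a * h n + X n) → ∀ n → g n ≡ h n
∂-unique a g₀≡h₀ ∂g ∂h zero    = g₀≡h₀
∂-unique a g₀≡h₀ ∂g ∂h (suc n) = ℕ→ℚ-suc-*-cancelˡ n
  (trans (∂g n) (trans (cong (λ z → a * z + _) (∂-unique a g₀≡h₀ ∂g ∂h n)) (sym (∂h n))))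

⊛-congˡ : ∀ {f g} h n → (∀ i → i ≤ n → f i ≡ g i) → (f ⊛ h) n ≡ (g ⊛ h) n
⊛-congˡ h n f≗g = sumTo-cong n (λ i i≤n → cong (_* h (n ∸ i)) (f≗g i i≤n))

⊛-congʳ : ∀ f {g h} n → (∀ i → i ≤ n → g i ≡ h i) → (f ⊛ g) n ≡ (f ⊛ h) n
⊛-congʳ f n g≗h = sumTo-cong n (λ i _ → cong (f i *_) (g≗h (n ∸ i) (ℕ.m∸n≤m n i)))

⊛-+ˡ : ∀ (f g h : PS) n → ((λ m → f m + g m) ⊛ h) n ≡ (f ⊛ h) n + (g ⊛ h) n
⊛-+ˡ f g h n = trans (sumTo-cong n (λ i _ → *-distribʳ-+ (h (n ∸ i)) (f i) (g i))) (sumTo-+ n _ _)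

⊛-+ʳ : ∀ (f g h : PS) n → (f ⊛ (λ m → g m + h m)) n ≡ (f ⊛ g) n + (f ⊛ h) n
⊛-+ʳ f g h n = trans (sumTo-cong n (λ i _ → *-distribˡ-+ (f i) (g (n ∸ i)) (h (n ∸ i)))) (sumTo-+ n _ _)

⊛-*ˡ : ∀ c (f g : PS) n → ((λ m → c * f m) ⊛ g) n ≡ c * (f ⊛ g) n
⊛-*ˡ c f g n = trans (sumTo-cong n (λ i _ → *-assoc c (f i) (g (n ∸ i)))) (sumTo-*ˡ n c _)

⊛-*ʳ : ∀ c (f g : PS) n → (f ⊛ (λ m → c * g m)) n ≡ c * (f ⊛ g) n
⊛-*ʳ c f g n = trans (sumTo-cong n (λ i _ → solve 3 (λ a b c → a :* (c :* b) := c :* (a :* b)) refl (f i) (g (n ∸ i)) c))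
                     (sumTo-*ˡ n c _)

⊛-negˡ : ∀ (f g : PS) n → ((λ m → - f m) ⊛ g) n ≡ - (f ⊛ g) n
⊛-negˡ f g n = trans (sumTo-cong n (λ i _ → sym (neg-distribˡ-* (f i) (g (n ∸ i))))) (sumTo-neg n _)

⊛-negʳ : ∀ (f g : PS) n → (f ⊛ (λ m → - g m)) n ≡ - (f ⊛ g) n
⊛-negʳ f g n = trans (sumTo-cong n (λ i _ → sym (neg-distribʳ-* (f i) (g (n ∸ i))))) (sumTo-neg n _)

⊛-zeroˡ : ∀ {f} g n → (∀ i → f i ≡ 0ℚ) → (f ⊛ g) n ≡ 0ℚ
⊛-zeroˡ g n f≗0 = sumTo-zero n (λ i → trans (cong (_* g (n ∸ i)) (f≗0 i)) (*-zeroˡ (g (n ∸ i))))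

⊛-zeroʳ : ∀ f {g} n → (∀ i → g i ≡ 0ℚ) → (f ⊛ g) n ≡ 0ℚ
⊛-zeroʳ f n g≗0 = sumTo-zero n (λ i → trans (cong (f i *_) (g≗0 (n ∸ i))) (*-zeroʳ (f i)))

⊛-identityˡ : ∀ f g n → ((f ^PS 0) ⊛ g) n ≡ g n
⊛-identityˡ f g zero    = *-identityˡ (g 0)
⊛-identityˡ f g (suc n) = begin
  ((f ^PS 0) ⊛ g) (suc n)                          ≡⟨ sumTo-suc-head n (λ i → (f ^PS 0) i * g (suc n ∸ i)) ⟩
  1ℚ * g (suc n) + sumTo n (λ i → 0ℚ * g (n ∸ i))  ≡⟨ cong₂ _+_ (*-identityˡ (g (suc n))) (sumTo-zero n (λ i → *-zeroˡ (g (n ∸ i)))) ⟩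
  g (suc n) + 0ℚ                                   ≡⟨ +-identityʳ (g (suc n)) ⟩
  g (suc n)                                        ∎

∂-⊛ : ∀ (f g : PS) n → ∂ (f ⊛ g) n ≡ (∂ f ⊛ g) n + (f ⊛ ∂ g) n
∂-⊛ f g n = begin
  N * sumTo (suc n) T                  ≡⟨ sym (sumTo-*ˡ (suc n) N T) ⟩
  sumTo (suc n) (λ i → N * T i)        ≡⟨ sumTo-cong (suc n) split ⟩
  sumTo (suc n) (λ i → A i + B i)      ≡⟨ sumTo-+ (suc n) A B ⟩
  sumTo (suc n) A + sumTo (suc n) B    ≡⟨ cong₂ _+_ ΣA ΣB ⟩
  (∂ f ⊛ g) n + (f ⊛ ∂ g) n            ∎
  where
  N = ℕ→ℚ (suc n)
  T A B : ℕ → ℚ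
  T i = f i * g (suc n ∸ i)
  A i = ℕ→ℚ i * T i
  B i = ℕ→ℚ (suc n ∸ i) * T i
  split : ∀ i → i ≤ suc n → N * T i ≡ A i + B i
  split i i≤ = begin
    N * T i                                    ≡⟨ cong (λ z → ℕ→ℚ z * T i) (sym (ℕ.m+[n∸m]≡n i≤)) ⟩
    ℕ→ℚ (i ℕ.+ (suc n ∸ i)) * T i              ≡⟨ cong (_* T i) (ℕ→ℚ-homo-+ i (suc n ∸ i)) ⟩
    (ℕ→ℚ i + ℕ→ℚ (suc n ∸ i)) * T i            ≡⟨ *-distribʳ-+ (T i) (ℕ→ℚ i) (ℕ→ℚ (suc n ∸ i)) ⟩
    A i + B i                                  ∎
  ΣA : sumTo (suc n) A ≡ (∂ f ⊛ g) n
  ΣA = begin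
    sumTo (suc n) A                            ≡⟨ sumTo-suc-head n A ⟩
    A 0 + sumTo n (λ i → A (suc i))            ≡⟨ cong (_+ sumTo n (λ i → A (suc i))) (*-zeroˡ (T 0)) ⟩
    0ℚ + sumTo n (λ i → A (suc i))             ≡⟨ +-identityˡ _ ⟩
    sumTo n (λ i → A (suc i))                  ≡⟨ sumTo-cong n (λ i _ → sym (*-assoc (ℕ→ℚ (suc i)) (f (suc i)) (g (n ∸ i)))) ⟩
    (∂ f ⊛ g) n                                ∎
  ΣB : sumTo (suc n) B ≡ (f ⊛ ∂ g) n
  ΣB = begin
    sumTo n B + B (suc n)                      ≡⟨ cong (λ z → sumTo n B + ℕ→ℚ z * T (suc n)) (ℕ.n∸n≡0 n) ⟩
    sumTo n B + 0ℚ * T (suc n)                 ≡⟨ cong (sumTo n B +_) (*-zeroˡ (T (suc n))) ⟩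
    sumTo n B + 0ℚ                             ≡⟨ +-identityʳ (sumTo n B) ⟩
    sumTo n B                                  ≡⟨ sumTo-cong n B≡ ⟩
    (f ⊛ ∂ g) n                                ∎
    where
    B≡ : ∀ i → i ≤ n → B i ≡ f i * ∂ g (n ∸ i)
    B≡ i i≤n = begin
      ℕ→ℚ (suc n ∸ i) * (f i * g (suc n ∸ i))          ≡⟨ cong (λ z → ℕ→ℚ z * (f i * g z)) (ℕ.+-∸-assoc 1 i≤n) ⟩
      ℕ→ℚ (suc (n ∸ i)) * (f i * g (suc (n ∸ i)))      ≡⟨ solve 3 (λ a b c → a :* (b :* c) := b :* (a :* c)) refl
                                                            (ℕ→ℚ (suc (n ∸ i))) (f i) (g (suc (n ∸ i))) ⟩
      f i * ∂ g (n ∸ i)                                ∎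

∂-expS : ∀ x n → ∂ (expS x) n ≡ x * expS x n
∂-expS x n = begin
  ℕ→ℚ (suc n) * ((x * (x ^ℚ n)) * inv-fact (suc n))  ≡⟨ solve 4 (λ N x X I → N :* ((x :* X) :* I) := x :* X :* (N :* I)) refl
                                                          (ℕ→ℚ (suc n)) x (x ^ℚ n) (inv-fact (suc n)) ⟩
  x * (x ^ℚ n) * (ℕ→ℚ (suc n) * inv-fact (suc n))    ≡⟨ cong (x * (x ^ℚ n) *_) (inv-fact-suc n) ⟩
  x * (x ^ℚ n) * inv-fact n                          ≡⟨ *-assoc x (x ^ℚ n) (inv-fact n) ⟩
  x * expS x n                                       ∎

∂-oneMinusExpNeg : ∀ n → ∂ oneMinusExpNeg n ≡ (oneMinusExpNeg ^PS 0) n - oneMinusExpNeg n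
∂-oneMinusExpNeg zero    = refl
∂-oneMinusExpNeg (suc n) = begin
  N * (- ((- 1ℚ) * s * I′))    ≡⟨ solve 3 (λ N s I′ → N :* (:- (con (- 1ℚ) :* s :* I′)) := s :* (N :* I′)) refl N s I′ ⟩
  s * (N * I′)                 ≡⟨ cong (s *_) (inv-fact-suc (suc n)) ⟩
  s * I                        ≡⟨ solve 2 (λ s I → s :* I := con 0ℚ :- (:- (s :* I))) refl s I ⟩
  0ℚ - (- (s * I))             ∎
  where N = ℕ→ℚ (suc (suc n)); s = sgn (suc n); I′ = inv-fact (suc (suc n)); I = inv-fact (suc n)

∂oneMinusExpNeg-⊛ : ∀ g n → (∂ oneMinusExpNeg ⊛ g) n ≡ g n - (oneMinusExpNeg ⊛ g) n
∂oneMinusExpNeg-⊛ g n = begin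
  (∂ u ⊛ g) n                                      ≡⟨ ⊛-congˡ g n (λ i _ → ∂-oneMinusExpNeg i) ⟩
  ((λ m → (u ^PS 0) m + - u m) ⊛ g) n              ≡⟨ ⊛-+ˡ (u ^PS 0) (λ m → - u m) g n ⟩
  ((u ^PS 0) ⊛ g) n + ((λ m → - u m) ⊛ g) n        ≡⟨ cong₂ _+_ (⊛-identityˡ u g n) (⊛-negˡ u g n) ⟩
  g n - (u ⊛ g) n                                  ∎
  where u = oneMinusExpNeg

∂-oneMinusExpNeg^suc : ∀ j n →
  ∂ (oneMinusExpNeg ^PS suc j) n ≡ ℕ→ℚ (suc j) * ((oneMinusExpNeg ^PS j) n - (oneMinusExpNeg ^PS suc j) n)
∂-oneMinusExpNeg^suc zero n = begin
  ∂ (u ⊛ U 0) n                            ≡⟨ ∂-⊛ u (U 0) n ⟩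
  (∂ u ⊛ U 0) n + (u ⊛ ∂ (U 0)) n          ≡⟨ cong₂ _+_ (∂oneMinusExpNeg-⊛ (U 0) n) (⊛-zeroʳ u n (λ i → *-zeroʳ (ℕ→ℚ (suc i)))) ⟩
  (U 0 n - U 1 n) + 0ℚ                     ≡⟨ solve 1 (λ x → x :+ con 0ℚ := con 1ℚ :* x) refl (U 0 n - U 1 n) ⟩
  1ℚ * (U 0 n - U 1 n)                     ∎
  where u = oneMinusExpNeg; U = oneMinusExpNeg ^PS_
∂-oneMinusExpNeg^suc (suc j) n = begin
  ∂ (u ⊛ U (suc j)) n                                      ≡⟨ ∂-⊛ u (U (suc j)) n ⟩
  (∂ u ⊛ U (suc j)) n + (u ⊛ ∂ (U (suc j))) n              ≡⟨ cong₂ _+_ (∂oneMinusExpNeg-⊛ (U (suc j)) n)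
                                                                         (⊛-congʳ u n (λ i _ → ∂-oneMinusExpNeg^suc j i)) ⟩
  x + (u ⊛ (λ m → J * (U j m - U (suc j) m))) n            ≡⟨ cong (x +_) (⊛-*ʳ J u (λ m → U j m - U (suc j) m) n) ⟩
  x + J * (u ⊛ (λ m → U j m + - U (suc j) m)) n            ≡⟨ cong (λ z → x + J * z) (⊛-+ʳ u (U j) (λ m → - U (suc j) m) n) ⟩
  x + J * (U (suc j) n + (u ⊛ (λ m → - U (suc j) m)) n)    ≡⟨ cong (λ z → x + J * (U (suc j) n + z)) (⊛-negʳ u (U (suc j)) n) ⟩
  x + J * x                                                ≡⟨ solve 2 (λ x J → x :+ J :* x := (con 1ℚ :+ J) :* x) refl x J ⟩
  (1ℚ + J) * x                                             ≡⟨ cong (_* x) (sym (ℕ→ℚ-suc (suc j))) ⟩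
  ℕ→ℚ (suc (suc j)) * x                                    ∎
  where
  u = oneMinusExpNeg; U = oneMinusExpNeg ^PS_
  J = ℕ→ℚ (suc j); x = U (suc j) n - U (suc (suc j)) n

signedStirlingEGF : ℕ → PS
signedStirlingEGF j m = sgn j * sgn m * ℕ→ℚ (j !) * ℕ→ℚ (Stirling2 m j) * inv-fact m

∂-signedStirlingEGF : ∀ j n → let J = ℕ→ℚ (suc j) in
  ∂ (signedStirlingEGF (suc j)) n ≡ - J * signedStirlingEGF (suc j) n + J * signedStirlingEGF j n
∂-signedStirlingEGF j n = begin
  N * ((- 1ℚ * sj) * (- 1ℚ * sn) * ℕ→ℚ (suc j !) * ℕ→ℚ (Stirling2 (suc n) (suc j)) * I′)
    ≡⟨ cong₂ (λ x y → N * ((- 1ℚ * sj) * (- 1ℚ * sn) * x * y * I′)) (ℕ→ℚ-homo-* (suc j) (j !)) S≡ ⟩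
  N * ((- 1ℚ * sj) * (- 1ℚ * sn) * (J * F) * (J * P + Q) * I′)
    ≡⟨ solve 8 (λ N sj sn J F P Q I′ → N :* ((con (- 1ℚ) :* sj) :* (con (- 1ℚ) :* sn) :* (J :* F) :* (J :* P :+ Q) :* I′)
                   := (sj :* sn :* (J :* F) :* (J :* P :+ Q)) :* (N :* I′)) refl N sj sn J F P Q I′ ⟩
  (sj * sn * (J * F) * (J * P + Q)) * (N * I′)
    ≡⟨ cong ((sj * sn * (J * F) * (J * P + Q)) *_) (inv-fact-suc n) ⟩
  (sj * sn * (J * F) * (J * P + Q)) * I
    ≡⟨ solve 7 (λ sj sn J F P Q I → (sj :* sn :* (J :* F) :* (J :* P :+ Q)) :* I
                   := :- J :* ((con (- 1ℚ) :* sj) :* sn :* (J :* F) :* P :* I) :+ J :* (sj :* sn :* F :* Q :* I))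
               refl sj sn J F P Q I ⟩
  - J * ((- 1ℚ * sj) * sn * (J * F) * P * I) + J * signedStirlingEGF j n
    ≡⟨ cong (λ x → - J * ((- 1ℚ * sj) * sn * x * P * I) + J * signedStirlingEGF j n) (sym (ℕ→ℚ-homo-* (suc j) (j !))) ⟩
  - J * signedStirlingEGF (suc j) n + J * signedStirlingEGF j n ∎
  where
  N = ℕ→ℚ (suc n); J = ℕ→ℚ (suc j); sj = sgn j; sn = sgn n; F = ℕ→ℚ (j !)
  P = ℕ→ℚ (Stirling2 n (suc j)); Q = ℕ→ℚ (Stirling2 n j); I = inv-fact n; I′ = inv-fact (suc n)
  S≡ : ℕ→ℚ (Stirling2 (suc n) (suc j)) ≡ J * P + Q
  S≡ = begin
    ℕ→ℚ (Stirling2 (suc n) (suc j))                                ≡⟨ cong ℕ→ℚ (Stirling2-suc n j) ⟩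
    ℕ→ℚ (suc j ℕ.* Stirling2 n (suc j) ℕ.+ Stirling2 n j)          ≡⟨ ℕ→ℚ-homo-+ (suc j ℕ.* Stirling2 n (suc j)) _ ⟩
    ℕ→ℚ (suc j ℕ.* Stirling2 n (suc j)) + Q                        ≡⟨ cong (_+ Q) (ℕ→ℚ-homo-* (suc j) (Stirling2 n (suc j))) ⟩
    J * P + Q                                                      ∎

oneMinusExpNeg^-coeff : ∀ j m → (oneMinusExpNeg ^PS j) m ≡ signedStirlingEGF j m
oneMinusExpNeg^-coeff zero zero    = refl
oneMinusExpNeg^-coeff zero (suc m) =
  sym (trans (cong (_* inv-fact (suc m)) (*-zeroʳ (sgn 0 * sgn (suc m) * 1ℚ))) (*-zeroˡ (inv-fact (suc m))))
oneMinusExpNeg^-coeff (suc j) = ∂-unique (- J) constant-terms ∂-lhs (∂-signedStirlingEGF j)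
  where
  U = oneMinusExpNeg ^PS_
  J = ℕ→ℚ (suc j)
  constant-terms : U (suc j) 0 ≡ signedStirlingEGF (suc j) 0
  constant-terms = trans (*-zeroˡ (U j 0))
    (sym (trans (cong (_* inv-fact 0) (*-zeroʳ (sgn (suc j) * sgn 0 * ℕ→ℚ (suc j !)))) (*-zeroˡ (inv-fact 0))))
  ∂-lhs : ∀ n → ∂ (U (suc j)) n ≡ - J * U (suc j) n + J * signedStirlingEGF j n
  ∂-lhs n = begin
    ∂ (U (suc j)) n                              ≡⟨ ∂-oneMinusExpNeg^suc j n ⟩
    J * (U j n - U (suc j) n)                    ≡⟨ cong (λ z → J * (z - U (suc j) n)) (oneMinusExpNeg^-coeff j n) ⟩
    J * (signedStirlingEGF j n - U (suc j) n)    ≡⟨ solve 3 (λ J x y → J :* (x :- y) := :- J :* y :+ J :* x) refl J _ (U (suc j) n) ⟩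
    - J * U (suc j) n + J * signedStirlingEGF j n ∎

SrEGF : ℕ → ℕ → PS
SrEGF c k n = ℕ→ℚ (Sr c n k) * inv-fact n

SrEGF↓ : ℕ → ℕ → PS
SrEGF↓ c zero    n = 0ℚ
SrEGF↓ c (suc k) n = SrEGF (suc c) k n

∂-SrEGF : ∀ c k n → ∂ (SrEGF c k) n ≡ ℕ→ℚ c * SrEGF c k n + SrEGF↓ c k n
∂-SrEGF c k n = begin
  N * (ℕ→ℚ (Sr c (suc n) k) * I′)      ≡⟨ solve 3 (λ N S I′ → N :* (S :* I′) := S :* (N :* I′)) refl N (ℕ→ℚ (Sr c (suc n) k)) I′ ⟩
  ℕ→ℚ (Sr c (suc n) k) * (N * I′)      ≡⟨ cong (ℕ→ℚ (Sr c (suc n) k) *_) (inv-fact-suc n) ⟩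
  ℕ→ℚ (Sr c (suc n) k) * I             ≡⟨ recurrence k ⟩
  ℕ→ℚ c * SrEGF c k n + SrEGF↓ c k n  ∎
  where
  N = ℕ→ℚ (suc n); I = inv-fact n; I′ = inv-fact (suc n); c′ = ℕ→ℚ c
  recurrence : ∀ k → ℕ→ℚ (Sr c (suc n) k) * I ≡ c′ * SrEGF c k n + SrEGF↓ c k n
  recurrence zero = begin
    ℕ→ℚ (c ℕ.* Sr c n 0) * I                ≡⟨ cong (_* I) (ℕ→ℚ-homo-* c (Sr c n 0)) ⟩
    c′ * ℕ→ℚ (Sr c n 0) * I                  ≡⟨ solve 3 (λ c′ S I → c′ :* S :* I := c′ :* (S :* I) :+ con 0ℚ) refl c′ (ℕ→ℚ (Sr c n 0)) I ⟩
    c′ * SrEGF c 0 n + 0ℚ                    ∎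
  recurrence (suc k) = begin
    ℕ→ℚ (c ℕ.* Sr c n (suc k) ℕ.+ Sr (suc c) n k) * I
      ≡⟨ cong (_* I) (trans (ℕ→ℚ-homo-+ (c ℕ.* Sr c n (suc k)) _) (cong (_+ ℕ→ℚ (Sr (suc c) n k)) (ℕ→ℚ-homo-* c _))) ⟩
    (c′ * ℕ→ℚ (Sr c n (suc k)) + ℕ→ℚ (Sr (suc c) n k)) * I
      ≡⟨ solve 4 (λ c′ S T I → (c′ :* S :+ T) :* I := c′ :* (S :* I) :+ T :* I) refl c′ (ℕ→ℚ (Sr c n (suc k))) (ℕ→ℚ (Sr (suc c) n k)) I ⟩
    c′ * SrEGF c (suc k) n + SrEGF↓ c (suc k) n ∎

-- Both sides solve  y′ = (d + c) y + SrEGF↓ (d + c) k  with the same constant term.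
SrEGF⊛expS : ∀ k d c n → (SrEGF d k ⊛ expS (ℕ→ℚ c)) n ≡ SrEGF (d ℕ.+ c) k n
SrEGF⊛expS k d c = ∂-unique (ℕ→ℚ (d ℕ.+ c)) (constant-terms k) ∂-lhs (∂-SrEGF (d ℕ.+ c) k)
  where
  E = expS (ℕ→ℚ c)
  g = SrEGF d k ⊛ E
  constant-terms : ∀ k → (SrEGF d k ⊛ E) 0 ≡ SrEGF (d ℕ.+ c) k 0
  constant-terms zero    = refl
  constant-terms (suc k) = refl
  SrEGF↓⊛expS : ∀ k n → (SrEGF↓ d k ⊛ E) n ≡ SrEGF↓ (d ℕ.+ c) k n
  SrEGF↓⊛expS zero    n = ⊛-zeroˡ E n (λ _ → refl)
  SrEGF↓⊛expS (suc k) n = SrEGF⊛expS k (suc d) c n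
  ∂-lhs : ∀ n → ∂ g n ≡ ℕ→ℚ (d ℕ.+ c) * g n + SrEGF↓ (d ℕ.+ c) k n
  ∂-lhs n = begin
    ∂ g n
      ≡⟨ ∂-⊛ (SrEGF d k) E n ⟩
    (∂ (SrEGF d k) ⊛ E) n + (SrEGF d k ⊛ ∂ E) n
      ≡⟨ cong₂ _+_ (⊛-congˡ E n (λ i _ → ∂-SrEGF d k i)) (⊛-congʳ (SrEGF d k) n (λ i _ → ∂-expS (ℕ→ℚ c) i)) ⟩
    ((λ m → ℕ→ℚ d * SrEGF d k m + SrEGF↓ d k m) ⊛ E) n + (SrEGF d k ⊛ (λ m → ℕ→ℚ c * E m)) n
      ≡⟨ cong₂ _+_ (⊛-+ˡ (λ m → ℕ→ℚ d * SrEGF d k m) (SrEGF↓ d k) E n) (⊛-*ʳ (ℕ→ℚ c) (SrEGF d k) E n) ⟩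
    (((λ m → ℕ→ℚ d * SrEGF d k m) ⊛ E) n + (SrEGF↓ d k ⊛ E) n) + ℕ→ℚ c * g n
      ≡⟨ cong (λ z → z + ℕ→ℚ c * g n) (cong₂ _+_ (⊛-*ˡ (ℕ→ℚ d) (SrEGF d k) E n) (SrEGF↓⊛expS k n)) ⟩
    (ℕ→ℚ d * g n + SrEGF↓ (d ℕ.+ c) k n) + ℕ→ℚ c * g n
      ≡⟨ solve 4 (λ d′ c′ G X → (d′ :* G :+ X) :+ c′ :* G := (d′ :+ c′) :* G :+ X) refl (ℕ→ℚ d) (ℕ→ℚ c) (g n) _ ⟩
    (ℕ→ℚ d + ℕ→ℚ c) * g n + SrEGF↓ (d ℕ.+ c) k n
      ≡⟨ cong (λ z → z * g n + SrEGF↓ (d ℕ.+ c) k n) (sym (ℕ→ℚ-homo-+ d c)) ⟩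
    ℕ→ℚ (d ℕ.+ c) * g n + SrEGF↓ (d ℕ.+ c) k n ∎

binomialTerm-ℚ : ∀ {n p} k r → p ≤ n →
  ℕ→ℚ ((n C p) ℕ.* Stirling2 p k ℕ.* r ^ (n ∸ p))
    ≡ ℕ→ℚ (n !) * inv-fact p * inv-fact (n ∸ p) * ℕ→ℚ (Stirling2 p k) * (ℕ→ℚ r ^ℚ (n ∸ p))
binomialTerm-ℚ {n} {p} k r p≤n = begin
  ℕ→ℚ ((n C p) ℕ.* Stirling2 p k ℕ.* r ^ (n ∸ p))
    ≡⟨ ℕ→ℚ-homo-* ((n C p) ℕ.* Stirling2 p k) (r ^ (n ∸ p)) ⟩
  ℕ→ℚ ((n C p) ℕ.* Stirling2 p k) * ℕ→ℚ (r ^ (n ∸ p))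
    ≡⟨ cong₂ _*_ (ℕ→ℚ-homo-* (n C p) (Stirling2 p k)) (ℕ→ℚ-homo-^ r (n ∸ p)) ⟩
  ℕ→ℚ (n C p) * ℕ→ℚ (Stirling2 p k) * (ℕ→ℚ r ^ℚ (n ∸ p))
    ≡⟨ cong (λ x → x * ℕ→ℚ (Stirling2 p k) * (ℕ→ℚ r ^ℚ (n ∸ p))) (binomial-ℚ p≤n) ⟩
  ℕ→ℚ (n !) * inv-fact p * inv-fact (n ∸ p) * ℕ→ℚ (Stirling2 p k) * (ℕ→ℚ r ^ℚ (n ∸ p)) ∎

binomial-Stirling2-sum : ∀ n r k →
  sumTo n (λ p → ℕ→ℚ ((n C p) ℕ.* Stirling2 p k ℕ.* r ^ (n ∸ p))) ≡ ℕ→ℚ (rStirling r (n ℕ.+ r) (k ℕ.+ r))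
binomial-Stirling2-sum n r k = begin
  sumTo n (λ p → ℕ→ℚ ((n C p) ℕ.* Stirling2 p k ℕ.* r ^ (n ∸ p)))
    ≡⟨ sumTo-cong n term ⟩
  sumTo n (λ p → n! * (SrEGF 0 k p * expS R (n ∸ p)))
    ≡⟨ sumTo-*ˡ n n! (λ p → SrEGF 0 k p * expS R (n ∸ p)) ⟩
  n! * (SrEGF 0 k ⊛ expS R) n
    ≡⟨ cong (n! *_) (SrEGF⊛expS k 0 r n) ⟩
  n! * (ℕ→ℚ (Sr r n k) * inv-fact n)
    ≡⟨ solve 3 (λ N S I → N :* (S :* I) := S :* (N :* I)) refl n! (ℕ→ℚ (Sr r n k)) (inv-fact n) ⟩
  ℕ→ℚ (Sr r n k) * (n! * inv-fact n)
    ≡⟨ cong (ℕ→ℚ (Sr r n k) *_) (!*inv-fact≡1 n) ⟩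
  ℕ→ℚ (Sr r n k) * 1ℚ
    ≡⟨ *-identityʳ _ ⟩
  ℕ→ℚ (Sr r n k)
    ≡⟨ cong ℕ→ℚ (sym (rStirling≡Sr r n k)) ⟩
  ℕ→ℚ (rStirling r (n ℕ.+ r) (k ℕ.+ r)) ∎
  where
  n! = ℕ→ℚ (n !); R = ℕ→ℚ r
  term : ∀ p → p ≤ n → ℕ→ℚ ((n C p) ℕ.* Stirling2 p k ℕ.* r ^ (n ∸ p)) ≡ n! * (SrEGF 0 k p * expS R (n ∸ p))
  term p p≤n = begin
    ℕ→ℚ ((n C p) ℕ.* Stirling2 p k ℕ.* r ^ (n ∸ p))
      ≡⟨ binomialTerm-ℚ k r p≤n ⟩
    n! * inv-fact p * inv-fact (n ∸ p) * ℕ→ℚ (Stirling2 p k) * (R ^ℚ (n ∸ p))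
      ≡⟨ cong (λ z → n! * inv-fact p * inv-fact (n ∸ p) * ℕ→ℚ z * (R ^ℚ (n ∸ p))) (Stirling2≡Sr p k) ⟩
    n! * inv-fact p * inv-fact (n ∸ p) * ℕ→ℚ (Sr 0 p k) * (R ^ℚ (n ∸ p))
      ≡⟨ solve 5 (λ N I J S X → N :* I :* J :* S :* X := N :* ((S :* I) :* (X :* J))) refl
           n! (inv-fact p) (inv-fact (n ∸ p)) (ℕ→ℚ (Sr 0 p k)) (R ^ℚ (n ∸ p)) ⟩
    n! * (SrEGF 0 k p * expS R (n ∸ p)) ∎

LiOver-coeff : ∀ q {i n} → i ≤ n → LiOver q i ≡ sumTo n (λ j → signedStirlingEGF j i * inv-pow j q)
LiOver-coeff q {i} i≤n =
  trans (sumTo-cong i (λ j _ → cong (_* inv-pow j q) (oneMinusExpNeg^-coeff j i))) (sumTo-extend _ i≤n vanish)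
  where
  vanish : ∀ j → i < j → signedStirlingEGF j i * inv-pow j q ≡ 0ℚ
  vanish j i<j = begin
    sgn j * sgn i * ℕ→ℚ (j !) * ℕ→ℚ (Stirling2 i j) * inv-fact i * inv-pow j q
      ≡⟨ cong (λ z → sgn j * sgn i * ℕ→ℚ (j !) * ℕ→ℚ z * inv-fact i * inv-pow j q) (Stirling2-vanish i<j) ⟩
    sgn j * sgn i * ℕ→ℚ (j !) * 0ℚ * inv-fact i * inv-pow j q
      ≡⟨ solve 5 (λ a b c d e → a :* b :* c :* con 0ℚ :* d :* e := con 0ℚ) refl
           (sgn j) (sgn i) (ℕ→ℚ (j !)) (inv-fact i) (inv-pow j q) ⟩
    0ℚ ∎

polyBernoulli-term : ∀ {n i} j r q → i ≤ n →
  ℕ→ℚ (n !) * (signedStirlingEGF j i * inv-pow j q * expS (- ℕ→ℚ r) (n ∸ i))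
    ≡ sgn n * (ℕ→ℚ (j !) * sgn j * inv-pow j q * ℕ→ℚ ((n C i) ℕ.* Stirling2 i j ℕ.* r ^ (n ∸ i)))
polyBernoulli-term {n} {i} j r q i≤n = begin
  n! * (sgn j * sgn i * F * S * inv-fact i * ip * ((- R) ^ℚ (n ∸ i) * inv-fact (n ∸ i)))
    ≡⟨ cong (λ z → n! * (sgn j * sgn i * F * S * inv-fact i * ip * (z * inv-fact (n ∸ i)))) (neg-^ℚ R (n ∸ i)) ⟩
  n! * (sgn j * sgn i * F * S * inv-fact i * ip * (sgn (n ∸ i) * Rᵉ * inv-fact (n ∸ i)))
    ≡⟨ solve 10 (λ N sj si F S Ii ip se Re Ie → N :* (sj :* si :* F :* S :* Ii :* ip :* (se :* Re :* Ie))
                    := (si :* se) :* (F :* sj :* ip :* (N :* Ii :* Ie :* S :* Re)))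
         refl n! (sgn j) (sgn i) F S (inv-fact i) ip (sgn (n ∸ i)) Rᵉ (inv-fact (n ∸ i)) ⟩
  (sgn i * sgn (n ∸ i)) * (F * sgn j * ip * (n! * inv-fact i * inv-fact (n ∸ i) * S * Rᵉ))
    ≡⟨ cong₂ (λ x y → x * (F * sgn j * ip * y)) sgn-split (sym (binomialTerm-ℚ j r i≤n)) ⟩
  sgn n * (F * sgn j * ip * ℕ→ℚ ((n C i) ℕ.* Stirling2 i j ℕ.* r ^ (n ∸ i))) ∎
  where
  n! = ℕ→ℚ (n !); F = ℕ→ℚ (j !); S = ℕ→ℚ (Stirling2 i j); ip = inv-pow j q
  R = ℕ→ℚ r; Rᵉ = R ^ℚ (n ∸ i)
  sgn-split : sgn i * sgn (n ∸ i) ≡ sgn n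
  sgn-split = trans (sym (sgn-+ i (n ∸ i))) (cong sgn (ℕ.m+[n∸m]≡n i≤n))

polyBernoulli-neg : ∀ n r q → polyBernoulli q n (- ℕ→ℚ r)
  ≡ sgn n * sumTo n (λ k → ℕ→ℚ (k !) * sgn k * inv-pow k q
      * sumTo n (λ p → ℕ→ℚ ((n C p) ℕ.* Stirling2 p k ℕ.* r ^ (n ∸ p))))
polyBernoulli-neg n r q = begin
  n! * sumTo n (λ i → LiOver q i * e i)
    ≡⟨ sym (sumTo-*ˡ n n! (λ i → LiOver q i * e i)) ⟩
  sumTo n (λ i → n! * (LiOver q i * e i))
    ≡⟨ sumTo-cong n expand ⟩
  sumTo n (λ i → sumTo n (λ j → n! * (s j i * inv-pow j q * e i)))
    ≡⟨ sumTo-swap n n (λ i j → n! * (s j i * inv-pow j q * e i)) ⟩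
  sumTo n (λ j → sumTo n (λ i → n! * (s j i * inv-pow j q * e i)))
    ≡⟨ sumTo-cong n (λ j _ → sumTo-cong n (λ i i≤n → polyBernoulli-term j r q i≤n)) ⟩
  sumTo n (λ j → sumTo n (λ i → sgn n * (K j * M j i)))
    ≡⟨ sumTo-cong n (λ j _ → trans (sumTo-*ˡ n (sgn n) (λ i → K j * M j i)) (cong (sgn n *_) (sumTo-*ˡ n (K j) (M j)))) ⟩
  sumTo n (λ j → sgn n * (K j * sumTo n (M j)))
    ≡⟨ sumTo-*ˡ n (sgn n) (λ j → K j * sumTo n (M j)) ⟩
  sgn n * sumTo n (λ j → K j * sumTo n (M j)) ∎
  where
  n! = ℕ→ℚ (n !)
  s = signedStirlingEGF
  e : ℕ → ℚ
  e i = expS (- ℕ→ℚ r) (n ∸ i)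
  K : ℕ → ℚ
  K j = ℕ→ℚ (j !) * sgn j * inv-pow j q
  M : ℕ → ℕ → ℚ
  M j i = ℕ→ℚ ((n C i) ℕ.* Stirling2 i j ℕ.* r ^ (n ∸ i))
  expand : ∀ i → i ≤ n → n! * (LiOver q i * e i) ≡ sumTo n (λ j → n! * (s j i * inv-pow j q * e i))
  expand i i≤n = begin
    n! * (LiOver q i * e i)                                 ≡⟨ cong (λ z → n! * (z * e i)) (LiOver-coeff q i≤n) ⟩
    n! * (sumTo n (λ j → s j i * inv-pow j q) * e i)        ≡⟨ cong (n! *_) (sym (sumTo-*ʳ n (e i) (λ j → s j i * inv-pow j q))) ⟩
    n! * sumTo n (λ j → s j i * inv-pow j q * e i)          ≡⟨ sym (sumTo-*ˡ n n! (λ j → s j i * inv-pow j q * e i)) ⟩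
    sumTo n (λ j → n! * (s j i * inv-pow j q * e i))        ∎

-- The identities hold for every q.
corollary5 : (n r q : ℕ) → 1 ≤ q →
    (polyBernoulli q n (- ℕ→ℚ r)
      ≡ sgn n * sumTo n (λ k → ℕ→ℚ (k !) * sgn k * inv-pow k q
          * sumTo n (λ p → ℕ→ℚ ((n C p) ℕ.* Stirling2 p k ℕ.* r ^ (n ∸ p)))))
    × (sgn n * sumTo n (λ k → ℕ→ℚ (k !) * sgn k * inv-pow k q
          * sumTo n (λ p → ℕ→ℚ ((n C p) ℕ.* Stirling2 p k ℕ.* r ^ (n ∸ p))))
      ≡ sgn n * sumTo n (λ k → ℕ→ℚ (k !) * sgn k * inv-pow k q
          * ℕ→ℚ (rStirling r (n ℕ.+ r) (k ℕ.+ r))))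
corollary5 n r q _ = polyBernoulli-neg n r q ,
  cong (sgn n *_) (sumTo-cong n (λ k _ → cong (ℕ→ℚ (k !) * sgn k * inv-pow k q *_) (binomial-Stirling2-sum n r k)))
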